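{- For all integers $k\ge2$ and $n\ge0$, $$a_{k,n}=\sum_{i=0}^{\left\lfloor\frac{n-2}{k+1}\right\rfloor+1}\binom{\left\lfloor\frac{n-i-1}{k}\right\rfloor+1}{i}.$$
   Context: For $k\ge1$, the sequence $(a_{k,n})_{n=0}^\infty$ is defined by $a_{k,0}=a_{k,1}=1$, $a_{k,2}=\cdots=a_{k,k}=2$, and $a_{k,n}=a_{k,n-k}+a_{k,n-k-1}$ for $n\ge k+1$. Here $\lfloor\cdot\rfloor$ is the floor function (so e.g. $\lfloor -1/k\rfloor=-1$), and $\binom{a}{b}$ is the usual binomial coefficient for nonnegative integers $a,b$. -}

module Defs where

open import Data.Nat using (ℕ; zero; suc; _+_; _∸_; _≤?_)
open import Data.Nat.Combinatorics using (_C_)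
open import Data.Integer using (ℤ; +_; -[1+_]; _/ℕ_)
open import Data.List using (map; upTo)
open import Data.Nat.ListAction using (sum)
open import Relation.Nullary using (yes; no)

-- a k n with fuel: aFuel (suc n) k n is the n-th term a_{k,n} for k ≥ 1
-- (n ∸ k < n when k ≥ 1 and n ≥ k+1, so fuel suc n suffices).
aFuel : ℕ → ℕ → ℕ → ℕ
aFuel zero k n = 0
aFuel (suc f) k zero = 1
aFuel (suc f) k (suc zero) = 1
aFuel (suc f) k (suc (suc m)) with suc (suc m) ≤? k
... | yes _ = 2
... | no _ = aFuel f k (suc (suc m) ∸ k) + aFuel f k (suc (suc m) ∸ k ∸ 1)

a : ℕ → ℕ → ℕ
a k n = aFuel (suc n) k n

-- floor division of an integer by a positive natural (divisor 0 gives 0, never used)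
floorDiv : ℤ → ℕ → ℤ
floorDiv x zero = + 0
floorDiv x (suc d) = x /ℕ suc d

-- binomial coefficient with integer top; 0 for negative top (never occurs here)
binomℤ : ℤ → ℕ → ℕ
binomℤ (+ m) i = m C i
binomℤ -[1+ m ] i = 0

sumTo : ℤ → (ℕ → ℕ) → ℕ
sumTo (+ L) f = sum (map f (upTo (suc L)))
sumTo -[1+ L ] f = 0

module Submission where

-- Write t(n, i) = C(⌊(n-i-1)/k⌋ + 1, i). Pascal's rule gives t(n, i+1) = t(n-k, i+1) + t(n-k-1, i)
-- for n > k, and t(n, 0) = 1, so the row sums Σᵢ t(n, i) obey the recurrence a(n) = a(n-k) + a(n-k-1);
-- for n ≤ k only t(n, 0) and (when n ≥ 2) t(n, 1) = 1 survive, matching the initial values. Every term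
-- with i > ⌊(n+k-1)/(k+1)⌋ vanishes since its top is then below i. The argument works for all k ≥ 1.

open import Defs
open import Data.Nat
  using (ℕ; zero; suc; _+_; _*_; _∸_; _/_; _%_; _≤_; _<_; _≤?_; z≤n; s≤s; s≤s⁻¹; z<s; NonZero; >-nonZero⁻¹)
open import Data.Nat.Properties
open import Algebra.Properties.CommutativeSemigroup +-commutativeSemigroup using (interchange)
open import Data.Nat.DivMod
open import Data.Nat.Induction using (<-rec)
open import Data.Nat.Combinatorics using (_C_; nCk+nC[k+1]≡[n+1]C[k+1]; nC1≡n)
open import Data.Nat.Combinatorics.Specification using (k>n⇒nCk≡0)
open import Data.Nat.ListAction using (sum)
open import Data.Integer as ℤ using (+_; -[1+_]; -_; _/ℕ_; -1ℤ)
import Data.Integer.Properties as ℤ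
open import Data.List using (applyUpTo)
open import Data.List.Properties using (map-upTo)
open import Data.Sum using (inj₁; inj₂)
open import Data.Product using (∃; _,_)
open import Function using (_∘_)
open import Relation.Nullary using (yes; no; contradiction)
open import Relation.Binary.PropositionalEquality

sumUpTo : (ℕ → ℕ) → ℕ → ℕ
sumUpTo f n = sum (applyUpTo f n)

sumUpTo-cong : ∀ {f g} n → (∀ {i} → i < n → f i ≡ g i) → sumUpTo f n ≡ sumUpTo g n
sumUpTo-cong zero    f≗g = refl
sumUpTo-cong (suc n) f≗g = cong₂ _+_ (f≗g z<s) (sumUpTo-cong n (f≗g ∘ s≤s))

sumUpTo-+ : ∀ f g n → sumUpTo (λ i → f i + g i) n ≡ sumUpTo f n + sumUpTo g n
sumUpTo-+ f g zero    = refl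
sumUpTo-+ f g (suc n) =
  trans (cong (λ s → f 0 + g 0 + s) (sumUpTo-+ (f ∘ suc) (g ∘ suc) n))
        (interchange (f 0) (g 0) (sumUpTo (f ∘ suc) n) (sumUpTo (g ∘ suc) n))

sumUpTo-truncate : ∀ f {m n} → (∀ {i} → m ≤ i → f i ≡ 0) → m ≤ n → sumUpTo f n ≡ sumUpTo f m
sumUpTo-truncate f {n = zero}   f≡0 z≤n       = refl
sumUpTo-truncate f {zero} {suc n} f≡0 z≤n       =
  cong₂ _+_ (f≡0 z≤n) (sumUpTo-truncate (f ∘ suc) {n = n} (λ {i} _ → f≡0 {suc i} z≤n) z≤n)
sumUpTo-truncate f {suc m}        f≡0 (s≤s m≤n) =
  cong (λ s → f 0 + s) (sumUpTo-truncate (f ∘ suc) (f≡0 ∘ s≤s) m≤n)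

m/o<n⇒m<n*o : ∀ {m n o} .{{_ : NonZero o}} → m / o < n → m < n * o
m/o<n⇒m<n*o {m} {n} {o} m/o<n = ≰⇒> λ n*o≤m →
  <⇒≱ m/o<n (subst (_≤ m / o) (m*n/n≡m n o) (/-monoˡ-≤ o n*o≤m))

[m+n]/n≡1+m/n : ∀ m n .{{_ : NonZero n}} → (m + n) / n ≡ suc (m / n)
[m+n]/n≡1+m/n m n =
  trans (m/n≡1+[m∸n]/n (m≤n+m n m)) (cong (λ x → suc (x / n)) (m+n∸n≡m m n))

-[j]/ℕn≡-1 : ∀ {j n} .{{_ : NonZero n}} → 0 < j → j ≤ n → (- + j) /ℕ n ≡ -1ℤ
-[j]/ℕn≡-1 {suc j} {n} _ j≤n with suc j % n in eq | m≤n⇒m<n∨m≡n j≤n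
... | zero  | inj₁ j<n = contradiction (trans (sym (m<n⇒m%n≡m j<n)) eq) λ ()
... | zero  | inj₂ refl = cong (λ q → - + q) (n/n≡1 (suc j))
... | suc _ | inj₁ j<n = cong -[1+_] (m<n⇒m/n≡0 j<n)
... | suc _ | inj₂ refl = contradiction (trans (sym eq) (n%n≡0 (suc j))) λ ()

[m-n]/ℕd+1≡[m+d∸n]/d : ∀ m n d .{{_ : NonZero d}} → n ≤ m + d →
                        (+ m ℤ.- + n) /ℕ d ℤ.+ + 1 ≡ + ((m + d ∸ n) / d)
[m-n]/ℕd+1≡[m+d∸n]/d m n d n≤m+d with n ≤? m
... | yes n≤m = begin
  (+ m ℤ.- + n) /ℕ d ℤ.+ + 1  ≡⟨ cong (λ x → x /ℕ d ℤ.+ + 1) (trans (ℤ.m-n≡m⊖n m n) (ℤ.⊖-≥ n≤m)) ⟩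
  + ((m ∸ n) / d + 1)         ≡⟨ cong +_ (+-comm _ 1) ⟩
  + suc ((m ∸ n) / d)         ≡⟨ cong +_ ([m+n]/n≡1+m/n (m ∸ n) d) ⟨
  + ((m ∸ n + d) / d)         ≡⟨ cong (λ x → + (x / d)) (+-∸-comm d n≤m) ⟨
  + ((m + d ∸ n) / d)         ∎
  where open ≡-Reasoning
... | no n≰m = begin
  (+ m ℤ.- + n) /ℕ d ℤ.+ + 1  ≡⟨ cong (λ x → x /ℕ d ℤ.+ + 1) (trans (ℤ.m-n≡m⊖n m n) (ℤ.⊖-< m<n)) ⟩
  (- + (n ∸ m)) /ℕ d ℤ.+ + 1  ≡⟨ cong (ℤ._+ + 1) (-[j]/ℕn≡-1 (m<n⇒0<n∸m m<n) (m≤n+o⇒m∸n≤o n m n≤m+d)) ⟩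
  + 0                         ≡⟨ cong +_ (m<n⇒m/n≡0 (m<n+o⇒m∸n<o (m + d) n (+-monoˡ-< d m<n))) ⟨
  + ((m + d ∸ n) / d)         ∎
  where open ≡-Reasoning
        m<n = ≰⇒> n≰m

module _ (k : ℕ) .{{_ : NonZero k}} where

  aFuel-fuel-irrelevant : ∀ {f g} n → n < f → n < g → aFuel f k n ≡ aFuel g k n
  aFuel-fuel-irrelevant {suc f} {suc g} zero          _           _           = refl
  aFuel-fuel-irrelevant {suc f} {suc g} (suc zero)    _           _           = refl
  aFuel-fuel-irrelevant {suc f} {suc g} (suc (suc m)) (s≤s n≤f) (s≤s n≤g) with suc (suc m) ≤? k
  ... | yes _   = refl
  ... | no  n≰k = cong₂ _+_ (aFuel-fuel-irrelevant _ (<-≤-trans n∸k<n n≤f) (<-≤-trans n∸k<n n≤g))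
                            (aFuel-fuel-irrelevant _ (≤-<-trans (m∸n≤m _ 1) (<-≤-trans n∸k<n n≤f))
                                                     (≤-<-trans (m∸n≤m _ 1) (<-≤-trans n∸k<n n≤g)))
    where n∸k<n = ∸-monoʳ-< (>-nonZero⁻¹ k) (<⇒≤ (≰⇒> n≰k))

  a-initial : ∀ {n} → 2 ≤ n → n ≤ k → a k n ≡ 2
  a-initial {n@(suc (suc _))} (s≤s (s≤s _)) n≤k with n ≤? k
  ... | yes _   = refl
  ... | no  n≰k = contradiction n≤k n≰k

  a-unfold : ∀ {n} → 2 ≤ n → k < n → a k n ≡ a k (n ∸ k) + a k (n ∸ k ∸ 1)
  a-unfold {n@(suc (suc _))} (s≤s (s≤s _)) k<n with n ≤? k
  ... | yes n≤k = contradiction n≤k (<⇒≱ k<n)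
  ... | no  _   = cong₂ _+_ (aFuel-fuel-irrelevant _ n∸k<n (n<1+n _))
                            (aFuel-fuel-irrelevant _ (≤-<-trans (m∸n≤m _ 1) n∸k<n) (n<1+n _))
    where n∸k<n = ∸-monoʳ-< (>-nonZero⁻¹ k) (<⇒≤ k<n)

  a-rec : ∀ p → a k (suc p + k) ≡ a k (suc p) + a k p
  a-rec p = trans (a-unfold (s≤s (≤-trans (>-nonZero⁻¹ k) (m≤n+m k p))) (m<n+m k z<s))
                  (cong₂ (λ u v → a k u + a k v) n∸k≡1+p (cong (_∸ 1) n∸k≡1+p))
    where n∸k≡1+p = m+n∸n≡m (suc p) k

  k<n⇒∃[p]1+p+k≡n : ∀ {n} → k < n → ∃ λ p → suc p + k ≡ n
  k<n⇒∃[p]1+p+k≡n {n} k<n = n ∸ suc k , trans (sym (+-suc (n ∸ suc k) k)) (m∸n+n≡m k<n)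

  -- ⌊(n-i-1)/k⌋ + 1 computed as ⌊(n+k-(i+1))/k⌋; where that would be negative, truncated subtraction
  -- gives top 0 instead, which changes nothing since then i ≥ n + k ≥ 1.
  term : ℕ → ℕ → ℕ
  term n i = ((n + k ∸ suc i) / k) C i

  term-vanishes : ∀ n {i} → n + k ∸ 1 < suc i * suc k → term n (suc i) ≡ 0
  term-vanishes n {i} lt = k>n⇒nCk≡0 (m<n*o⇒m/o<n top<i*k)
    where
    top<i*k : n + k ∸ suc (suc i) < suc i * k
    top<i*k = subst (_< suc i * k) (∸-+-assoc (n + k) 1 (suc i))
                (m<n+o⇒m∸n<o (n + k ∸ 1) (suc i) {{m*n≢0 (suc i) k}}
                  (subst (n + k ∸ 1 <_) (*-suc (suc i) k) lt))

  term-pascal : ∀ p i → term (suc p + k) (suc i) ≡ term (suc p) (suc i) + term p i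
  term-pascal p i with suc i ≤? p + k
  ... | yes i<p+k = begin
    ((p + k + k ∸ suc i) / k) C suc i  ≡⟨ cong (λ y → (y / k) C suc i) (+-∸-comm k i<p+k) ⟩
    ((x + k) / k) C suc i              ≡⟨ cong (_C suc i) ([m+n]/n≡1+m/n x k) ⟩
    suc (x / k) C suc i                ≡⟨ nCk+nC[k+1]≡[n+1]C[k+1] (x / k) i ⟨
    (x / k) C i + (x / k) C suc i      ≡⟨ +-comm ((x / k) C i) _ ⟩
    (x / k) C suc i + (x / k) C i      ∎
    where
    open ≡-Reasoning
    x = p + k ∸ suc i
  ... | no i≮p+k = trans lhs≡0 (sym rhs≡0)
    where
    open ≡-Reasoning
    p+k<1+i = ≰⇒> i≮p+k
    lhs≡0 : term (suc p + k) (suc i) ≡ 0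
    lhs≡0 = cong (_C suc i) (m<n⇒m/n≡0 (m<n+o⇒m∸n<o (p + k + k) (suc i) (+-monoˡ-< k p+k<1+i)))
    rhs≡0 : term (suc p) (suc i) + term p i ≡ 0
    rhs≡0 = begin
      ((p + k ∸ suc i) / k) C suc i + ((p + k ∸ suc i) / k) C i
        ≡⟨ cong (λ y → (y / k) C suc i + (y / k) C i) (m≤n⇒m∸n≡0 (<⇒≤ p+k<1+i)) ⟩
      (0 / k) C suc i + (0 / k) C i
        ≡⟨ cong (λ q → q C suc i + q C i) (0/n≡0 k) ⟩
      0 C i
        ≡⟨ k>n⇒nCk≡0 (≤-trans (>-nonZero⁻¹ k) (≤-trans (m≤n+m k p) (s≤s⁻¹ p+k<1+i))) ⟩
      0 ∎

  sumUpTo-term-rec : ∀ p B → sumUpTo (term (suc p + k)) (suc B) ≡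
                             sumUpTo (term (suc p)) (suc B) + sumUpTo (term p) B
  sumUpTo-term-rec p B = begin
    1 + sumUpTo (term (suc p + k) ∘ suc) B                     ≡⟨ cong suc (sumUpTo-cong B λ _ → term-pascal p _) ⟩
    1 + sumUpTo (λ i → term (suc p) (suc i) + term p i) B      ≡⟨ cong suc (sumUpTo-+ (term (suc p) ∘ suc) (term p) B) ⟩
    1 + (sumUpTo (term (suc p) ∘ suc) B + sumUpTo (term p) B)  ≡⟨ +-assoc 1 (sumUpTo (term (suc p) ∘ suc) B) (sumUpTo (term p) B) ⟨
    sumUpTo (term (suc p)) (suc B) + sumUpTo (term p) B        ∎
    where open ≡-Reasoning

  term-vanishes-≤1 : ∀ {n i} → n ≤ 1 → term n (suc i) ≡ 0
  term-vanishes-≤1 {n} {i} n≤1 = term-vanishes n (begin-strict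
    n + k ∸ 1      ≤⟨ m≤n+o⇒m∸n≤o (n + k) 1 (+-monoˡ-≤ k n≤1) ⟩
    k              <⟨ n<1+n k ⟩
    suc k          ≤⟨ m≤n*m (suc k) (suc i) ⟩
    suc i * suc k  ∎)
    where open ≤-Reasoning

  term-vanishes-≤k : ∀ {n i} → n ≤ k → term n (suc (suc i)) ≡ 0
  term-vanishes-≤k {n} {i} n≤k = term-vanishes n (begin-strict
    n + k ∸ 1                        ≤⟨ m∸n≤m (n + k) 1 ⟩
    n + k                            ≤⟨ +-monoˡ-≤ k n≤k ⟩
    k + k                            <⟨ +-mono-< (n<1+n k) (n<1+n k) ⟩
    suc k + suc k                    ≤⟨ +-monoʳ-≤ (suc k) (m≤m+n (suc k) (i * suc k)) ⟩
    suc (suc i) * suc k              ∎)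
    where open ≤-Reasoning

  term-1 : ∀ {m} → suc (suc m) ≤ k → term (suc (suc m)) 1 ≡ 1
  term-1 {m} n≤k = begin
    ((m + k) / k) C 1  ≡⟨ nC1≡n _ ⟩
    (m + k) / k        ≡⟨ [m+n]/n≡1+m/n m k ⟩
    suc (m / k)        ≡⟨ cong suc (m<n⇒m/n≡0 (≤-trans (n≤1+n (suc m)) n≤k)) ⟩
    1                  ∎
    where open ≡-Reasoning

  a≡sumUpTo-term-initial : ∀ {n B} → n ≤ k → n < B → a k n ≡ sumUpTo (term n) B
  a≡sumUpTo-term-initial {zero}        _   n<B =
    sym (sumUpTo-truncate (term 0) (λ { (s≤s _) → term-vanishes-≤1 z≤n }) n<B)
  a≡sumUpTo-term-initial {suc zero}    _   n<B =
    sym (sumUpTo-truncate (term 1) (λ { (s≤s _) → term-vanishes-≤1 ≤-refl }) (<⇒≤ n<B))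
  a≡sumUpTo-term-initial {suc (suc m)} {B} n≤k n<B = begin
    a k (suc (suc m))                ≡⟨ a-initial (s≤s (s≤s z≤n)) n≤k ⟩
    2                                ≡⟨ cong (λ t → 1 + (t + 0)) (term-1 n≤k) ⟨
    sumUpTo (term (suc (suc m))) 2   ≡⟨ sumUpTo-truncate (term (suc (suc m)))
                                          (λ { (s≤s (s≤s _)) → term-vanishes-≤k n≤k })
                                          (≤-trans (s≤s (s≤s z≤n)) (<⇒≤ n<B)) ⟨
    sumUpTo (term (suc (suc m))) B   ∎
    where open ≡-Reasoning

  -- Any range B > n covers all nonzero terms, so the recurrence can shift B freely.
  a≡sumUpTo-term : ∀ n {B} → n < B → a k n ≡ sumUpTo (term n) B
  a≡sumUpTo-term = <-rec _ step
    where
    step : ∀ n → (∀ {m} → m < n → ∀ {B} → m < B → a k m ≡ sumUpTo (term m) B) →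
           ∀ {B} → n < B → a k n ≡ sumUpTo (term n) B
    step n rec {zero}  ()
    step n rec {suc B} n<B with n ≤? k
    ... | yes n≤k = a≡sumUpTo-term-initial n≤k n<B
    ... | no  n≰k with p , refl ← k<n⇒∃[p]1+p+k≡n (≰⇒> n≰k) = begin
      a k (suc p + k)                                       ≡⟨ a-rec p ⟩
      a k (suc p) + a k p                                   ≡⟨ cong₂ _+_ (rec 1+p<n (s≤s 1+p≤B)) (rec p<n 1+p≤B) ⟩
      sumUpTo (term (suc p)) (suc B) + sumUpTo (term p) B   ≡⟨ sumUpTo-term-rec p B ⟨
      sumUpTo (term (suc p + k)) (suc B)                    ∎
      where
      open ≡-Reasoning
      1+p<n = m<m+n (suc p) (>-nonZero⁻¹ k)
      p<n = <-trans (n<1+n p) 1+p<n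
      1+p≤B = <⇒≤ (<-≤-trans 1+p<n (s≤s⁻¹ n<B))

+m-+i-+1≡+m-+[1+i] : ∀ m i → + m ℤ.- + i ℤ.- + 1 ≡ + m ℤ.- + suc i
+m-+i-+1≡+m-+[1+i] m i = begin
  + m ℤ.- + i ℤ.- + 1            ≡⟨ ℤ.+-assoc (+ m) (- + i) (- + 1) ⟩
  + m ℤ.+ (- + i ℤ.+ - + 1)      ≡⟨ cong (λ z → + m ℤ.+ z) (ℤ.neg-distrib-+ (+ i) (+ 1)) ⟨
  + m ℤ.- + (i + 1)              ≡⟨ cong (λ j → + m ℤ.- + j) (+-comm i 1) ⟩
  + m ℤ.- + suc i                ∎
  where open ≡-Reasoning

a≡sumTo-binomℤ : ∀ k .{{_ : NonZero k}} n →
  a k n ≡ sumTo ((+ n ℤ.- + 2) /ℕ suc k ℤ.+ + 1) (λ i → binomℤ ((+ n ℤ.- + i ℤ.- + 1) /ℕ k ℤ.+ + 1) i)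
a≡sumTo-binomℤ k n = begin
  a k n                                ≡⟨ a≡sumUpTo-term k n (s≤s (m≤m+n n (suc U))) ⟩
  sumUpTo (term k n) (suc n + suc U)   ≡⟨ sumUpTo-truncate (term k n) term≡0 (m≤n+m (suc U) (suc n)) ⟩
  sumUpTo (term k n) (suc U)           ≡⟨ sumUpTo-cong (suc U) binomℤ≡term ⟨
  sumUpTo g (suc U)                    ≡⟨ cong sum (map-upTo g (suc U)) ⟨
  sumTo (+ U) g                        ≡⟨ cong (λ L → sumTo L g) upper≡U ⟨
  sumTo ((+ n ℤ.- + 2) /ℕ suc k ℤ.+ + 1) g ∎
  where
  open ≡-Reasoning
  g : ℕ → ℕ
  g i = binomℤ ((+ n ℤ.- + i ℤ.- + 1) /ℕ k ℤ.+ + 1) i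
  U : ℕ
  U = (n + suc k ∸ 2) / suc k
  n+1+k∸2≡n+k∸1 : n + suc k ∸ 2 ≡ n + k ∸ 1
  n+1+k∸2≡n+k∸1 = cong (_∸ 2) (+-suc n k)
  1≤n+k : 1 ≤ n + k
  1≤n+k = ≤-trans (>-nonZero⁻¹ k) (m≤n+m k n)
  upper≡U : (+ n ℤ.- + 2) /ℕ suc k ℤ.+ + 1 ≡ + U
  upper≡U = [m-n]/ℕd+1≡[m+d∸n]/d n 2 (suc k) (subst (2 ≤_) (sym (+-suc n k)) (s≤s 1≤n+k))
  term≡0 : ∀ {i} → suc U ≤ i → term k n i ≡ 0
  term≡0 {suc i} U<1+i = term-vanishes k n (subst (_< suc i * suc k) n+1+k∸2≡n+k∸1 (m/o<n⇒m<n*o U<1+i))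
  binomℤ≡term : ∀ {i} → i < suc U → g i ≡ term k n i
  binomℤ≡term {i} (s≤s i≤U) = cong (λ z → binomℤ z i) (begin
    (+ n ℤ.- + i ℤ.- + 1) /ℕ k ℤ.+ + 1  ≡⟨ cong (λ z → z /ℕ k ℤ.+ + 1) (+m-+i-+1≡+m-+[1+i] n i) ⟩
    (+ n ℤ.- + suc i) /ℕ k ℤ.+ + 1      ≡⟨ [m-n]/ℕd+1≡[m+d∸n]/d n (suc i) k 1+i≤n+k ⟩
    + ((n + k ∸ suc i) / k)             ∎)
    where
    1+i≤n+k : suc i ≤ n + k
    1+i≤n+k = ≤-<-trans (≤-trans i≤U (≤-trans (m/n≤m _ (suc k)) (≤-reflexive n+1+k∸2≡n+k∸1)))
                        (∸-monoʳ-< z<s 1≤n+k)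

lemma2p1 : (k n : ℕ) → 2 ≤ k →
    a k n ≡ sumTo (floorDiv (+ n ℤ.- + 2) (suc k) ℤ.+ + 1)
                  (λ i → binomℤ (floorDiv (+ n ℤ.- + i ℤ.- + 1) k ℤ.+ + 1) i)
lemma2p1 k n (s≤s (s≤s _)) = a≡sumTo-binomℤ k n
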